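{- Let $A_t$, $\mathcal{I}$, $\mathbf{v}[\cdot]$ and $\mathsf{type}$ be as in the context. Then: (1) For $a<b<c$ in $\mathcal{I}$, $\mathsf{type}(a,c)\le\mathsf{type}(b,c)$. (2) Suppose $A_t(a,c)=A_t(b,c)=1$ with $a<b$, and write $c-a=\mathbf{v}[i_1,\dots,i_t]$, $c-b=\mathbf{v}[j_1,\dots,j_t]$. If $\mathsf{type}(a,b)=r$, then $i_q=j_q$ for all $q<r$, $i_r<j_r$, and the first coordinate (in lexicographic order) in which $a$ and $b$ differ is $(r,i_r)$. (3) Suppose $A_t(a,c)=A_t(a,d)=1$ with $c<d$, and write $c-a=\mathbf{v}[i_1,\dots,i_t]$, $d-a=\mathbf{v}[j_1,\dots,j_t]$. If $\mathsf{type}(c,d)=r$, then $i_q=j_q$ for all $q<r$, $i_r>j_r$, and the first coordinate in which $c$ and $d$ differ is $(r,j_r)$. (4) Suppose $A_t(b,c_1)=A_t(a,c_2)=A_t(b,d)=A_t(a,d)=1$ where $a<b$ and $c_1<c_2<d$. Then it is not possible that $\mathsf{type}(a,b)=\mathsf{type}(c_1,d)=\mathsf{type}(c_2,d)$. (5) Suppose $A_t(a,c_0)=A_t(b,c_1)=A_t(a,c_2)=A_t(b,d)=A_t(a,d)=1$ where $a<b$ and $c_0<c_1<c_2<d$. If $\mathsf{type}(a,b)\le\mathsf{type}(c_0,d)$, then $\mathsf{type}(c_0,d)<\mathsf{type}(c_2,d)$.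
   Context: Let $[k]=\{1,\dots,k\}$, $t\ge 2$ a fixed integer and $k$ a positive integer. Let $\mathcal{I}=[k^t]^{tk}$; an element $a\in\mathcal{I}$ is viewed as $t$ consecutive blocks of length $k$, $a(p)\in[k^t]^k$ denotes its $p$-th block and $a(p,q)$ the $q$-th coordinate of the $p$-th block. $\mathcal{I}$ is ordered lexicographically (coordinates $(p,q)$ ordered lexicographically), and comparisons $a<b$ refer to this order. For $r\ge 0$ and $(j_1,\dots,j_r)\in[k]^r$ let $\langle j_1,\dots,j_r\rangle=1+\sum_{s=1}^r (j_s-1)k^{r-s}$ (injective into $[k^r]$, with $\langle\ \rangle=1$). For $(j_1,\dots,j_t)\in[k]^t$, $\mathbf{v}[j_1,\dots,j_t]\in\mathbb{Z}^{tk}$ is the vector that is $0$ in every coordinate except that coordinate $(r,j_r)$ equals $\langle j_1,\dots,j_{r-1}\rangle$ for each $r\in[t]$; $\mathcal{S}$ is the set of all such vectors. $A_t$ is the 0--1 matrix with rows and columns indexed by $\mathcal{I}$ (in lexicographic order) with $A_t(a,b)=1$ iff $b-a\in\mathcal{S}$. For distinct $a,b\in\mathcal{I}$, $\mathsf{type}(a,b)=\min\{r : a(r)\ne b(r)\}$, the first block in which they differ. All row and column indices in the claim are elements of $\mathcal{I}$. -}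

module Defs where

open import Data.Nat as ℕ using (ℕ; _+_; _*_; _^_)
open import Data.Integer as ℤ using (ℤ; +_; _-_)
open import Data.Fin as Fin using (Fin; toℕ)
open import Data.Fin.Properties using (_≟_)
open import Data.List using (List; foldl; take)
open import Data.Vec using (Vec; lookup; toList)
open import Data.Product using (Σ; ∃; _×_)
open import Data.Sum using (_⊎_)
open import Relation.Nullary using (¬_; does)
open import Relation.Binary.PropositionalEquality using (_≡_; _≢_)
open import Data.Bool using (if_then_else_)

-- The entry value x ∈ [k^t] is represented by Fin (k ^ t) (x ↦ x - 1);
-- this shift does not affect differences or the lexicographic order.
I : ℕ → ℕ → Set
I t k = Fin t → Fin k → Fin (k ^ t)

-- Coordinate (p,q) of a : a p q. Indices j ∈ [k] are Fin k (j ↦ j - 1).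

-- ⟨ j₁ , … , j_r ⟩ = 1 + Σ_s (j_s - 1) k^{r-s}  (Horner evaluation)
⟨_⟩ : {k : ℕ} → List (Fin k) → ℕ
⟨_⟩ {k} js = 1 + foldl (λ acc j → acc * k + toℕ j) 0 js

-- v[j₁,…,j_t] : coordinate (r, j_r) equals ⟨ j₁,…,j_{r-1} ⟩, others 0.
v : {t k : ℕ} → Vec (Fin k) t → Fin t → Fin k → ℕ
v j r q = if does (q ≟ lookup j r) then ⟨ take (toℕ r) (toList j) ⟩ else 0

DiffIs : {t k : ℕ} → I t k → I t k → Vec (Fin k) t → Set
DiffIs b a j = ∀ r q → (+ toℕ (b r q)) - (+ toℕ (a r q)) ≡ + (v j r q)

-- A_t(a,b) = 1  iff  b - a ∈ 𝓢
A : {t k : ℕ} → I t k → I t k → Set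
A {t} {k} a b = Σ (Vec (Fin k) t) (λ j → DiffIs b a j)

_<c_ : {t k : ℕ} → (Fin t × Fin k) → (Fin t × Fin k) → Set
(p' Data.Product., q') <c (p Data.Product., q) = p' Fin.< p ⊎ (p' ≡ p × q' Fin.< q)

FirstDiff : {t k : ℕ} → I t k → I t k → Fin t → Fin k → Set
FirstDiff a b p q =
  (a p q ≢ b p q) ×
  (∀ p' q' → (p' Data.Product., q') <c (p Data.Product., q) → a p' q' ≡ b p' q')

_<L_ : {t k : ℕ} → I t k → I t k → Set
a <L b = ∃ λ p → ∃ λ q → FirstDiff a b p q × toℕ (a p q) ℕ.< toℕ (b p q)

IsType : {t k : ℕ} → I t k → I t k → Fin t → Set
IsType a b r =
  (¬ (∀ q → a r q ≡ b r q)) ×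
  (∀ r' → r' Fin.< r → ∀ q → a r' q ≡ b r' q)

-- An edge adds to each block r the value ⟨j₁,…,j_{r−1}⟩ at the single coordinate (r, j_r).
-- If X < Y satisfy X + v[i] = Y + v[j] (two points with a common successor, or with a common
-- predecessor), then i and j agree on the blocks before type(X,Y) = r, so the two shifts in block r
-- have the same size; compensating them forces the first difference of X and Y to be (r, i_r) with
-- i_r < j_r. Parts (4) and (5) compare first differences along the chain c₁ < c₂ < d, using that a
-- point squeezed lexicographically between two points agreeing on an initial segment agrees with
-- them there too.

module Submission where

open import Defs
import Data.Nat as ℕ
open import Data.Nat using (ℕ; _≤_; suc; _+_; _*_; _⊓_; z<s; s<s; s≤s)
import Data.Nat.Properties as ℕₚ
open import Data.Nat.DivMod using (_%_; m≤n⇒m%n≡m; [m+kn]%n≡m%n)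
import Data.Integer as ℤ
import Data.Integer.Properties as ℤₚ
open import Data.Fin using (Fin; _<_; toℕ; _≟_)
import Data.Fin.Properties as Finₚ
open import Data.List using (List; _∷_; _∷ʳ_; foldl; take; length)
import Data.List.Properties as Listₚ
open import Data.List.Reverse using (Reverse; []; _∶_∶ʳ_; reverseView)
open import Data.Vec using (Vec; lookup; toList)
import Data.Vec.Properties as Vecₚ
open import Data.Product using (_×_; ∃; ∃-syntax; _,_; proj₁; proj₂)
open import Data.Product.Relation.Binary.Lex.Strict using (×-transitive; ×-compare)
open import Data.Product.Relation.Binary.Pointwise.NonDependent using (≡×≡⇒≡; ≡⇒≡×≡)
open import Data.Sum using (_⊎_; inj₁; inj₂)
open import Data.Bool using (if_then_else_)
open import Function using (_∘_)
open import Data.Empty using (⊥; ⊥-elim)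
open import Relation.Nullary using (¬_; yes; no; contradiction)
open import Relation.Nullary.Decidable using (dec-true; dec-false; decidable-stable)
open import Relation.Binary.Definitions using (Transitive; Trichotomous; tri<; tri≈; tri>)
open import Relation.Binary.PropositionalEquality
  using (_≡_; _≢_; refl; sym; trans; cong; cong₂; subst; isEquivalence; resp₂; module ≡-Reasoning)
open import Algebra.Properties.AbelianGroup ℤₚ.+-0-abelianGroup using (//-rightDividesˡ)
open import Algebra.Properties.CommutativeSemigroup ℕₚ.+-commutativeSemigroup using (xy∙z≈xz∙y)

private
  variable
    E : Set
    t k : ℕ
    a b c d c₀ c₁ c₂ X Y : I t k
    i j : Vec (Fin k) t
    p r s : Fin t
    q : Fin k

+-diff⇒≡+ : ∀ {m n o} → ℤ.+ m ℤ.- ℤ.+ n ≡ ℤ.+ o → m ≡ n + o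
+-diff⇒≡+ {m} {n} {o} e = ℤₚ.+-injective (begin
  ℤ.+ m                      ≡⟨ //-rightDividesˡ (ℤ.+ n) (ℤ.+ m) ⟨
  (ℤ.+ m ℤ.- ℤ.+ n) ℤ.+ ℤ.+ n  ≡⟨ cong (ℤ._+ ℤ.+ n) e ⟩
  ℤ.+ o ℤ.+ ℤ.+ n            ≡⟨ ℤₚ.+-comm (ℤ.+ o) (ℤ.+ n) ⟩
  ℤ.+ n ℤ.+ ℤ.+ o            ≡⟨ ℤₚ.pos-+ n o ⟨
  ℤ.+ (n + o)                ∎)
  where open ≡-Reasoning

m+o≡n+p∧m<n⇒p<o : ∀ {m n o p} → m + o ≡ n + p → m ℕ.< n → p ℕ.< o
m+o≡n+p∧m<n⇒p<o e m<n = ℕₚ.≰⇒> (λ o≤p → ℕₚ.<-irrefl e (ℕₚ.+-mono-<-≤ m<n o≤p))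

quot-rem-unique : ∀ {K m n r s} → r ℕ.< K → s ℕ.< K → m * K + r ≡ n * K + s → m ≡ n × r ≡ s
quot-rem-unique {suc K} {m} {n} {r} {s} (s≤s r≤K) (s≤s s≤K) e = m≡n , r≡s
  where
  open ≡-Reasoning
  r≡s : r ≡ s
  r≡s = begin
    r                       ≡⟨ m≤n⇒m%n≡m r≤K ⟨
    r % suc K               ≡⟨ [m+kn]%n≡m%n r m (suc K) ⟨
    (r + m * suc K) % suc K ≡⟨ cong (_% suc K) (trans (ℕₚ.+-comm r _) (trans e (ℕₚ.+-comm _ s))) ⟩
    (s + n * suc K) % suc K ≡⟨ [m+kn]%n≡m%n s n (suc K) ⟩
    s % suc K               ≡⟨ m≤n⇒m%n≡m s≤K ⟩
    s                       ∎
  m≡n : m ≡ n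
  m≡n = ℕₚ.*-cancelʳ-≡ m n (suc K) (ℕₚ.+-cancelʳ-≡ _ _ _ (trans e (cong ((n * suc K) +_) (sym r≡s))))

-- Horner evaluation and prefixes of vectors

length-∷ʳ : ∀ (xs : List E) x → length (xs ∷ʳ x) ≡ suc (length xs)
length-∷ʳ xs x = trans (Listₚ.length-++ xs) (ℕₚ.+-comm (length xs) 1)

horner : List (Fin k) → ℕ
horner {k} = foldl (λ acc j → acc * k + toℕ j) 0

horner-∷ʳ : ∀ (xs : List (Fin k)) x → horner (xs ∷ʳ x) ≡ horner xs * k + toℕ x
horner-∷ʳ xs x = Listₚ.foldl-∷ʳ _ 0 x xs

horner-injective : {xs ys : List (Fin k)} → Reverse xs → Reverse ys →
                   length xs ≡ length ys → horner xs ≡ horner ys → xs ≡ ys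
horner-injective [] [] _ _ = refl
horner-injective [] (ys ∶ _ ∶ʳ y) len _ with () ← trans len (length-∷ʳ ys y)
horner-injective (xs ∶ _ ∶ʳ x) [] len _ with () ← trans (sym (length-∷ʳ xs x)) len
horner-injective (xs ∶ rxs ∶ʳ x) (ys ∶ rys ∶ʳ y) len eq
  with quot-rem-unique (Finₚ.toℕ<n x) (Finₚ.toℕ<n y) (trans (sym (horner-∷ʳ xs x)) (trans eq (horner-∷ʳ ys y)))
... | xs≡ys , x≡y = cong₂ _∷ʳ_ (horner-injective rxs rys len′ xs≡ys) (Finₚ.toℕ-injective x≡y)
  where
  len′ : length xs ≡ length ys
  len′ = ℕₚ.suc-injective (trans (sym (length-∷ʳ xs x)) (trans len (length-∷ʳ ys y)))

length-take-toList : ∀ {n} m (xs : Vec E n) → length (take m (toList xs)) ≡ m ⊓ n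
length-take-toList m xs = trans (Listₚ.length-take m (toList xs)) (cong (m ⊓_) (Vecₚ.length-toList xs))

lookup-≡⇒take-toList-≡ : ∀ {n} (xs ys : Vec E n) m →
  (∀ q → toℕ q ℕ.< m → lookup xs q ≡ lookup ys q) → take m (toList xs) ≡ take m (toList ys)
lookup-≡⇒take-toList-≡ xs ys ℕ.zero _ = refl
lookup-≡⇒take-toList-≡ Vec.[] Vec.[] (suc m) _ = refl
lookup-≡⇒take-toList-≡ (x Vec.∷ xs) (y Vec.∷ ys) (suc m) eq =
  cong₂ _∷_ (eq Fin.zero z<s) (lookup-≡⇒take-toList-≡ xs ys m (λ q q<m → eq (Fin.suc q) (s<s q<m)))

take-toList-≡⇒lookup-≡ : ∀ {n} (xs ys : Vec E n) m q → toℕ q ℕ.< m →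
  take m (toList xs) ≡ take m (toList ys) → lookup xs q ≡ lookup ys q
take-toList-≡⇒lookup-≡ (x Vec.∷ xs) (y Vec.∷ ys) (suc m) Fin.zero _ eq = Listₚ.∷-injectiveˡ eq
take-toList-≡⇒lookup-≡ (x Vec.∷ xs) (y Vec.∷ ys) (suc m) (Fin.suc q) (s<s q<m) eq =
  take-toList-≡⇒lookup-≡ xs ys m q q<m (Listₚ.∷-injectiveʳ eq)

⟨_↾_⟩ : Vec (Fin k) t → Fin t → ℕ
⟨ j ↾ r ⟩ = ⟨ take (toℕ r) (toList j) ⟩

⟨↾⟩-cong : (∀ q → q < r → lookup i q ≡ lookup j q) → ⟨ i ↾ r ⟩ ≡ ⟨ j ↾ r ⟩
⟨↾⟩-cong {r = r} {i = i} {j = j} eq = cong ⟨_⟩ (lookup-≡⇒take-toList-≡ i j (toℕ r) eq)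

⟨↾⟩-injective : ∀ (i j : Vec (Fin k) t) → ⟨ i ↾ s ⟩ ≡ ⟨ j ↾ s ⟩ → r < s → lookup i r ≡ lookup j r
⟨↾⟩-injective {s = s} {r = r} i j eq r<s = take-toList-≡⇒lookup-≡ i j (toℕ s) r r<s
  (horner-injective (reverseView _) (reverseView _)
    (trans (length-take-toList (toℕ s) i) (sym (length-take-toList (toℕ s) j)))
    (ℕₚ.suc-injective eq))

v-on : ∀ (j : Vec (Fin k) t) r → v j r (lookup j r) ≡ ⟨ j ↾ r ⟩
v-on j r = cong (λ hit → if hit then ⟨ j ↾ r ⟩ else 0) (dec-true (lookup j r ≟ lookup j r) refl)

v-off : ∀ (j : Vec (Fin k) t) → q ≢ lookup j r → v j r q ≡ 0
v-off {q = q} {r = r} j q≢jᵣ = cong (λ hit → if hit then ⟨ j ↾ r ⟩ else 0) (dec-false (q ≟ lookup j r) q≢jᵣ)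

v-support : ∀ (j : Vec (Fin k) t) → v j r q ≢ 0 → q ≡ lookup j r
v-support {r = r} {q = q} j v≢0 = decidable-stable (q ≟ lookup j r) (v≢0 ∘ v-off j)

v-≗⇒lookup-≡ : ∀ (i j : Vec (Fin k) t) → (∀ q → v i r q ≡ v j r q) → lookup i r ≡ lookup j r
v-≗⇒lookup-≡ {r = r} i j vᵢ≗vⱼ = v-support j (λ vⱼ≡0 → ⟨↾⟩≢0 (trans (sym (v-on i r)) (trans (vᵢ≗vⱼ (lookup i r)) vⱼ≡0)))
  where
  ⟨↾⟩≢0 : ⟨ i ↾ r ⟩ ≢ 0
  ⟨↾⟩≢0 ()

DiffIs⇒≡+v : DiffIs b a j → ∀ p q → toℕ (b p q) ≡ toℕ (a p q) + v j p q
DiffIs⇒≡+v b-a p q = +-diff⇒≡+ (b-a p q)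

DiffIs-off : DiffIs b a j → q ≢ lookup j p → toℕ (b p q) ≡ toℕ (a p q)
DiffIs-off {b = b} {a = a} {j = j} {q = q} {p = p} b-a q≢jₚ =
  trans (DiffIs⇒≡+v {b = b} {a = a} b-a p q) (trans (cong (toℕ (a p q) +_) (v-off j q≢jₚ)) (ℕₚ.+-identityʳ _))

DiffIs-on : DiffIs b a j → toℕ (b p (lookup j p)) ≡ toℕ (a p (lookup j p)) + ⟨ j ↾ p ⟩
DiffIs-on {b = b} {a = a} {j = j} {p = p} b-a =
  trans (DiffIs⇒≡+v {b = b} {a = a} b-a p (lookup j p)) (cong (toℕ (a p (lookup j p)) +_) (v-on j p))

-- The lexicographic order on 𝓘

Coord : ℕ → ℕ → Set
Coord t k = Fin t × Fin k

private
  variable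
    x y z w : Coord t k
    P : Coord t k → Set

at : I t k → Coord t k → Fin (k ℕ.^ t)
at a (p , q) = a p q

<c-trans : Transitive (_<c_ {t} {k})
<c-trans = ×-transitive {_<₁_ = _<_} {_<₂_ = _<_} isEquivalence (resp₂ _<_) Finₚ.<-trans Finₚ.<-trans

<c-cmp : Trichotomous _≡_ (_<c_ {t} {k})
<c-cmp x y with ×-compare {_<₁_ = _<_} {_<₂_ = _<_} sym Finₚ.<-cmp Finₚ.<-cmp x y
... | tri< x<y x≢y x≯y = tri< x<y (x≢y ∘ ≡⇒≡×≡) x≯y
... | tri≈ x≮y x≡y x≯y = tri≈ x≮y (≡×≡⇒≡ x≡y) x≯y
... | tri> x≮y x≢y x>y = tri> x≮y (x≢y ∘ ≡⇒≡×≡) x>y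

_≤c_ : Coord t k → Coord t k → Set
x ≤c y = x <c y ⊎ x ≡ y

<c-≤c-trans : x <c y → y ≤c z → x <c z
<c-≤c-trans x<y (inj₁ y<z) = <c-trans x<y y<z
<c-≤c-trans x<y (inj₂ refl) = x<y

<c⇒block-≤ : x <c y → proj₁ x Data.Fin.≤ proj₁ y
<c⇒block-≤ (inj₁ p<p′) = ℕₚ.<⇒≤ p<p′
<c⇒block-≤ (inj₂ (p≡p′ , _)) = Finₚ.≤-reflexive p≡p′

Agree : I t k → I t k → (Coord t k → Set) → Set
Agree a b P = ∀ {w} → P w → at a w ≡ at b w

DownClosed : (Coord t k → Set) → Set
DownClosed P = ∀ {w z} → w <c z → P z → P w

FirstDiffAt : I t k → I t k → Coord t k → Set
FirstDiffAt a b (p , q) = FirstDiff a b p q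

LessAt : I t k → I t k → Coord t k → Set
LessAt a b x = FirstDiffAt a b x × at a x < at b x

agree-before : FirstDiffAt a b x → Agree a b (_<c x)
agree-before {x = _ , _} (_ , agree) {_ , _} = agree _ _

firstDiffAt : at a x ≢ at b x → Agree a b (_<c x) → FirstDiffAt a b x
firstDiffAt {x = _ , _} a≢b agree = a≢b , λ _ _ → agree

firstDiffAt-sym : FirstDiffAt a b x → FirstDiffAt b a x
firstDiffAt-sym {x = _ , _} (a≢b , agree) = a≢b ∘ sym , λ p q w<x → sym (agree p q w<x)

lessAt : Agree a b (_<c x) → at a x < at b x → LessAt a b x
lessAt agree a<b = firstDiffAt (Finₚ.<⇒≢ a<b) agree , a<b

<L⇒lessAt : a <L b → ∃ (LessAt a b)
<L⇒lessAt (p , q , a<b) = (p , q) , a<b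

lessAt⇒<L : LessAt a b x → a <L b
lessAt⇒<L {x = p , q} a<b = p , q , a<b

firstDiffAt-unique : FirstDiffAt a b x → FirstDiffAt a b y → x ≡ y
firstDiffAt-unique {x = x} {y = y} fx fy with <c-cmp x y
... | tri< x<y _ _ = contradiction (agree-before fy x<y) (proj₁ fx)
... | tri≈ _ x≡y _ = x≡y
... | tri> _ _ y<x = contradiction (agree-before fx y<x) (proj₁ fy)

<L-at-firstDiff : a <L b → FirstDiffAt a b x → LessAt a b x
<L-at-firstDiff {a = a} {b = b} a<b fx with <L⇒lessAt a<b
... | y , fy , a<b-at-y = fx , subst (λ z → at a z < at b z) (firstDiffAt-unique fy fx) a<b-at-y

<L-asym : a <L b → b <L a → ⊥
<L-asym a<b b<a with <L⇒lessAt a<b | <L⇒lessAt b<a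
... | x , fx , a<b-at-x | y , fy , b<a-at-y with firstDiffAt-unique fx (firstDiffAt-sym fy)
... | refl = Finₚ.<-asym a<b-at-x b<a-at-y

lessAt-trans : LessAt a b x → LessAt b c y → ∃[ z ] LessAt a c z × z ≤c x
lessAt-trans {x = x} {y = y} (fx , a<b) (fy , b<c) with <c-cmp x y
... | tri< x<y _ _ =
  x , lessAt (λ w<x → trans (agree-before fx w<x) (agree-before fy (<c-trans w<x x<y)))
             (Finₚ.<-respʳ-≡ (agree-before fy x<y) a<b) , inj₂ refl
... | tri≈ _ refl _ =
  x , lessAt (λ w<x → trans (agree-before fx w<x) (agree-before fy w<x)) (Finₚ.<-trans a<b b<c) , inj₂ refl
... | tri> _ _ y<x =
  y , lessAt (λ w<y → trans (agree-before fx (<c-trans w<y y<x)) (agree-before fy w<y))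
             (Finₚ.<-respˡ-≡ (sym (agree-before fx y<x)) b<c) , inj₁ y<x

<L-trans : a <L b → b <L c → a <L c
<L-trans a<b b<c with <L⇒lessAt a<b | <L⇒lessAt b<c
... | _ , a<b-at-x | _ , b<c-at-y with lessAt-trans a<b-at-x b<c-at-y
... | _ , a<c-at-z , _ = lessAt⇒<L a<c-at-z

agree-between : DownClosed P → a <L b → b <L c → Agree a c P → Agree a b P
agree-between closed a<b b<c a≈c {w} Pw with <L⇒lessAt a<b | <L⇒lessAt b<c
... | _ , a<b-at-x@(fx , _) | _ , b<c-at-y with lessAt-trans a<b-at-x b<c-at-y
... | z , (fz , _) , z≤x with <c-cmp w z
...   | tri< w<z _ _ = agree-before fx (<c-≤c-trans w<z z≤x)
...   | tri≈ _ refl _ = contradiction (a≈c Pw) (proj₁ fz)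
...   | tri> _ _ z<w = contradiction (a≈c (closed z<w Pw)) (proj₁ fz)

firstDiffAt-agree : Agree a c (_≤c x) → FirstDiffAt a b x → FirstDiffAt c b y → x ≡ y
firstDiffAt-agree a≈c fx fy = firstDiffAt-unique
  (firstDiffAt (λ c≡b → proj₁ fx (trans (a≈c (inj₂ refl)) c≡b))
               (λ w<x → trans (sym (a≈c (inj₁ w<x))) (agree-before fx w<x)))
  fy

lessAt-before-firstDiff : LessAt a b x → x <c y → FirstDiffAt c b y → LessAt a c x
lessAt-before-firstDiff (fx , a<b) x<y fy =
  lessAt (λ w<x → trans (agree-before fx w<x) (sym (agree-before fy (<c-trans w<x x<y))))
         (Finₚ.<-respʳ-≡ (sym (agree-before fy x<y)) a<b)

IsType-unique : IsType a b r → IsType a b s → r ≡ s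
IsType-unique {r = r} {s = s} (a≉b-at-r , a≈b-before-r) (a≉b-at-s , a≈b-before-s) with Finₚ.<-cmp r s
... | tri< r<s _ _ = contradiction (a≈b-before-s r r<s) a≉b-at-r
... | tri≈ _ r≡s _ = r≡s
... | tri> _ _ s<r = contradiction (a≈b-before-r s s<r) a≉b-at-s

firstDiff⇒IsType : FirstDiff a b p q → IsType a b p
firstDiff⇒IsType {q = q} (a≢b , agree) = (λ a≈b → a≢b (a≈b q)) , λ r r<p q′ → agree r q′ (inj₁ r<p)

<L⇒IsType : a <L b → ∃ (IsType a b)
<L⇒IsType (p , _ , fd , _) = p , firstDiff⇒IsType fd

type-≤-between : (a b c : I t k) → a <L b → b <L c → (r s : Fin t) →
  IsType a c r → IsType b c s → r Data.Fin.≤ s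
type-≤-between a b c a<b b<c r s (_ , a≈c-before-r) (b≉c-at-s , _) = ℕₚ.≮⇒≥ s≮r
  where
  s≮r : ¬ s < r
  s≮r s<r = b≉c-at-s (λ q → trans (sym (a≈b {s , q} Finₚ.≤-refl)) (a≈c-before-r s s<r q))
    where
    a≈b : Agree a b (λ w → proj₁ w Data.Fin.≤ s)
    a≈b = agree-between (λ w<z z≤s → Finₚ.≤-trans (<c⇒block-≤ w<z) z≤s) a<b b<c
            (λ {w} w≤s → a≈c-before-r (proj₁ w) (ℕₚ.≤-<-trans w≤s s<r) (proj₂ w))

type-squeezed : a <L b → b <L c → c <L d → IsType a d s → IsType c d s → IsType b d s
type-squeezed {a = a} {b = b} {c = c} {d = d} {s = s} a<b b<c c<d a-d c-d with <L⇒IsType (<L-trans b<c c<d)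
... | s′ , b-d = subst (IsType b d) (Finₚ.≤-antisym
  (type-≤-between b c d b<c c<d s′ s b-d c-d) (type-≤-between a b d a<b (<L-trans b<c c<d) s s′ a-d b-d)) b-d

-- Two points with a common shift

infix 4 _+v_≗_+v_
_+v_≗_+v_ : I t k → Vec (Fin k) t → I t k → Vec (Fin k) t → Set
X +v i ≗ Y +v j = ∀ p q → toℕ (X p q) + v i p q ≡ toℕ (Y p q) + v j p q

common-upper⇒+v≗ : ∀ (a b c : I t k) → DiffIs c a i → DiffIs c b j → a +v i ≗ b +v j
common-upper⇒+v≗ a b c c-a c-b p q =
  trans (sym (DiffIs⇒≡+v {b = c} {a = a} c-a p q)) (DiffIs⇒≡+v {b = c} {a = b} c-b p q)

common-lower⇒+v≗ : ∀ (a c d : I t k) → DiffIs c a i → DiffIs d a j → c +v j ≗ d +v i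
common-lower⇒+v≗ {i = i} {j = j} a c d c-a d-a p q = begin
  toℕ (c p q) + v j p q            ≡⟨ cong (_+ v j p q) (DiffIs⇒≡+v {b = c} {a = a} c-a p q) ⟩
  toℕ (a p q) + v i p q + v j p q  ≡⟨ xy∙z≈xz∙y (toℕ (a p q)) (v i p q) (v j p q) ⟩
  toℕ (a p q) + v j p q + v i p q  ≡⟨ cong (_+ v i p q) (DiffIs⇒≡+v {b = d} {a = a} d-a p q) ⟨
  toℕ (d p q) + v i p q            ∎
  where open ≡-Reasoning

+v≗-prefix : X +v i ≗ Y +v j → IsType X Y r → ∀ p → p < r → lookup i p ≡ lookup j p
+v≗-prefix {X = X} {i = i} {Y = Y} {j = j} E (_ , X≈Y-before) p p<r = v-≗⇒lookup-≡ i j λ q →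
  ℕₚ.+-cancelˡ-≡ (toℕ (X p q)) _ _ (trans (E p q) (cong (λ y → toℕ y + v j p q) (sym (X≈Y-before p p<r q))))

+v≗-firstDiff : X +v i ≗ Y +v j → ⟨ i ↾ r ⟩ ≡ ⟨ j ↾ r ⟩ → LessAt X Y (r , q) →
                q ≡ lookup i r × lookup i r < lookup j r
+v≗-firstDiff {X = X} {i = i} {Y = Y} {j = j} {r = r} {q = q} E ⟨i⟩≡⟨j⟩ (fd , X<Y) = q≡iᵣ , iᵣ<jᵣ
  where
  vⱼ<vᵢ : v j r q ℕ.< v i r q
  vⱼ<vᵢ = m+o≡n+p∧m<n⇒p<o (E r q) X<Y
  q≡iᵣ : q ≡ lookup i r
  q≡iᵣ = v-support i (ℕₚ.m<n⇒n≢0 vⱼ<vᵢ)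
  q≢jᵣ : q ≢ lookup j r
  q≢jᵣ q≡jᵣ = ℕₚ.<-irrefl vⱼ≡vᵢ vⱼ<vᵢ
    where
    vⱼ≡vᵢ : v j r q ≡ v i r q
    vⱼ≡vᵢ = begin
      v j r q             ≡⟨ cong (v j r) q≡jᵣ ⟩
      v j r (lookup j r)  ≡⟨ v-on j r ⟩
      ⟨ j ↾ r ⟩           ≡⟨ ⟨i⟩≡⟨j⟩ ⟨
      ⟨ i ↾ r ⟩           ≡⟨ v-on i r ⟨
      v i r (lookup i r)  ≡⟨ cong (v i r) q≡iᵣ ⟨
      v i r q             ∎
      where open ≡-Reasoning
  jᵣ≮iᵣ : ¬ lookup j r < lookup i r
  jᵣ≮iᵣ jᵣ<iᵣ = ℕₚ.m+1+n≢m (toℕ (Y r jᵣ)) (sym Y-shifted)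
    where
    jᵣ = lookup j r
    X≡Y : X r jᵣ ≡ Y r jᵣ
    X≡Y = agree-before fd (inj₂ (refl , subst (jᵣ <_) (sym q≡iᵣ) jᵣ<iᵣ))
    Y-shifted : toℕ (Y r jᵣ) ≡ toℕ (Y r jᵣ) + ⟨ j ↾ r ⟩
    Y-shifted = begin
      toℕ (Y r jᵣ)                 ≡⟨ cong toℕ X≡Y ⟨
      toℕ (X r jᵣ)                 ≡⟨ ℕₚ.+-identityʳ _ ⟨
      toℕ (X r jᵣ) + 0             ≡⟨ cong (toℕ (X r jᵣ) +_) (v-off i (Finₚ.<⇒≢ jᵣ<iᵣ)) ⟨
      toℕ (X r jᵣ) + v i r jᵣ      ≡⟨ E r jᵣ ⟩
      toℕ (Y r jᵣ) + v j r jᵣ      ≡⟨ cong (toℕ (Y r jᵣ) +_) (v-on j r) ⟩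
      toℕ (Y r jᵣ) + ⟨ j ↾ r ⟩     ∎
      where open ≡-Reasoning
  iᵣ<jᵣ : lookup i r < lookup j r
  iᵣ<jᵣ = Finₚ.≤∧≢⇒< (ℕₚ.≮⇒≥ jᵣ≮iᵣ) (λ iᵣ≡jᵣ → q≢jᵣ (trans q≡iᵣ iᵣ≡jᵣ))

+v≗-first-diff : X <L Y → IsType X Y r → X +v i ≗ Y +v j →
  ((q : Fin t) → q < r → lookup i q ≡ lookup j q) × (lookup i r < lookup j r) × FirstDiff X Y r (lookup i r)
+v≗-first-diff X<Y T E with <L⇒lessAt X<Y
... | (p , q) , X<Y-at@(fd , _) with IsType-unique (firstDiff⇒IsType fd) T
... | refl with +v≗-firstDiff E (⟨↾⟩-cong (+v≗-prefix E T)) X<Y-at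
... | refl , iₚ<jₚ = +v≗-prefix E T , iₚ<jₚ , fd

common-upper-first-diff : (a b c : I t k) (i j : Vec (Fin k) t) → a <L b →
  DiffIs c a i → DiffIs c b j → (r : Fin t) → IsType a b r →
  ((q : Fin t) → q < r → lookup i q ≡ lookup j q) × (lookup i r < lookup j r) × FirstDiff a b r (lookup i r)
common-upper-first-diff a b c _ _ a<b c-a c-b _ T = +v≗-first-diff a<b T (common-upper⇒+v≗ a b c c-a c-b)

common-lower-first-diff : (a c d : I t k) (i j : Vec (Fin k) t) → c <L d →
  DiffIs c a i → DiffIs d a j → (r : Fin t) → IsType c d r →
  ((q : Fin t) → q < r → lookup i q ≡ lookup j q) × (lookup j r < lookup i r) × FirstDiff c d r (lookup j r)
common-lower-first-diff a c d _ _ c<d c-a d-a _ T with +v≗-first-diff c<d T (common-lower⇒+v≗ a c d c-a d-a)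
... | prefix , jᵣ<iᵣ , fd = (λ q q<r → sym (prefix q q<r)) , jᵣ<iᵣ , fd

no-crossing : (a b c₁ c₂ d : I t k) → A b c₁ → A a c₂ → A b d → A a d →
  a <L b → c₁ <L c₂ → c₂ <L d → (r : Fin t) →
  IsType a b r → IsType c₁ d r → IsType c₂ d r → ⊥
no-crossing a b c₁ c₂ d (j₁ , c₁-b) (i₂ , c₂-a) (j , d-b) (i , d-a) a<b c₁<c₂ c₂<d r a-b c₁-d c₂-d =
  <L-asym c₁<c₂ (lessAt⇒<L (lessAt-before-firstDiff (<L-at-firstDiff c₂<d fd₂) (inj₂ (refl , iᵣ<jᵣ)) fd₁))
  where
  iᵣ<jᵣ : lookup i r < lookup j r
  iᵣ<jᵣ = proj₁ (proj₂ (common-upper-first-diff a b d i j a<b d-a d-b r a-b))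
  fd₂ : FirstDiff c₂ d r (lookup i r)
  fd₂ = proj₂ (proj₂ (common-lower-first-diff a c₂ d i₂ i c₂<d c₂-a d-a r c₂-d))
  fd₁ : FirstDiff c₁ d r (lookup j r)
  fd₁ = proj₂ (proj₂ (common-lower-first-diff b c₁ d j₁ j (<L-trans c₁<c₂ c₂<d) c₁-b d-b r c₁-d))

-- As i and j already differ in block r < s, ⟨i↾s⟩ ≢ ⟨j↾s⟩ by injectivity of Horner evaluation;
-- but c₁, squeezed between c₀ and c₂, makes a and b agree at (s, iₛ) with iₛ = jₛ, so d − a = d − b there.
no-nesting : (a b c₀ c₁ c₂ d : I t k) → A a c₀ → A b c₁ → A a c₂ → A b d → A a d →
  a <L b → c₀ <L c₁ → c₁ <L c₂ → c₂ <L d → (r s : Fin t) →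
  IsType a b r → r < s → IsType c₀ d s → IsType c₁ d s → IsType c₂ d s → ⊥
no-nesting a b c₀ c₁ c₂ d (i₀ , c₀-a) (j₁ , c₁-b) (i₂ , c₂-a) (j , d-b) (i , d-a)
           a<b c₀<c₁ c₁<c₂ c₂<d r s a-b r<s c₀-d c₁-d c₂-d
  with common-upper-first-diff a b d i j a<b d-a d-b r a-b
     | common-lower-first-diff a c₀ d i₀ i (<L-trans c₀<c₁ (<L-trans c₁<c₂ c₂<d)) c₀-a d-a s c₀-d
     | common-lower-first-diff b c₁ d j₁ j (<L-trans c₁<c₂ c₂<d) c₁-b d-b s c₁-d
     | common-lower-first-diff a c₂ d i₂ i c₂<d c₂-a d-a s c₂-d
... | _ , iᵣ<jᵣ , _ | _ , iₛ<i₀ₛ , fd₀ | _ , jₛ<j₁ₛ , fd₁ | _ , iₛ<i₂ₛ , fd₂ =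
  Finₚ.<⇒≢ iᵣ<jᵣ (⟨↾⟩-injective i j ⟨i↾s⟩≡⟨j↾s⟩ r<s)
  where
  iₛ = lookup i s
  c₀≡a : toℕ (c₀ s iₛ) ≡ toℕ (a s iₛ)
  c₀≡a = DiffIs-off {b = c₀} {a = a} c₀-a (Finₚ.<⇒≢ iₛ<i₀ₛ)
  c₂≡a : toℕ (c₂ s iₛ) ≡ toℕ (a s iₛ)
  c₂≡a = DiffIs-off {b = c₂} {a = a} c₂-a (Finₚ.<⇒≢ iₛ<i₂ₛ)
  c₀≈c₂ : Agree c₀ c₂ (_≤c (s , iₛ))
  c₀≈c₂ (inj₁ w<x) = trans (agree-before fd₀ w<x) (sym (agree-before fd₂ w<x))
  c₀≈c₂ (inj₂ refl) = Finₚ.toℕ-injective (trans c₀≡a (sym c₂≡a))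
  c₀≈c₁ : Agree c₀ c₁ (_≤c (s , iₛ))
  c₀≈c₁ = agree-between (λ w<z z≤x → inj₁ (<c-≤c-trans w<z z≤x)) c₀<c₁ c₁<c₂ c₀≈c₂
  iₛ≡jₛ : iₛ ≡ lookup j s
  iₛ≡jₛ = cong proj₂ (firstDiffAt-agree c₀≈c₁ fd₀ fd₁)
  c₁≡b : toℕ (c₁ s iₛ) ≡ toℕ (b s iₛ)
  c₁≡b = DiffIs-off {b = c₁} {a = b} c₁-b (λ iₛ≡j₁ₛ → Finₚ.<⇒≢ jₛ<j₁ₛ (trans (sym iₛ≡jₛ) iₛ≡j₁ₛ))
  a≡b : toℕ (a s iₛ) ≡ toℕ (b s iₛ)
  a≡b = trans (sym c₀≡a) (trans (cong toℕ (c₀≈c₁ (inj₂ refl))) c₁≡b)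
  ⟨i↾s⟩≡⟨j↾s⟩ : ⟨ i ↾ s ⟩ ≡ ⟨ j ↾ s ⟩
  ⟨i↾s⟩≡⟨j↾s⟩ = ℕₚ.+-cancelˡ-≡ (toℕ (a s iₛ)) _ _ (begin
    toℕ (a s iₛ) + ⟨ i ↾ s ⟩            ≡⟨ DiffIs-on {b = d} {a = a} d-a ⟨
    toℕ (d s iₛ)                        ≡⟨ cong (λ q → toℕ (d s q)) iₛ≡jₛ ⟩
    toℕ (d s (lookup j s))              ≡⟨ DiffIs-on {b = d} {a = b} d-b ⟩
    toℕ (b s (lookup j s)) + ⟨ j ↾ s ⟩  ≡⟨ cong (λ q → toℕ (b s q) + ⟨ j ↾ s ⟩) iₛ≡jₛ ⟨
    toℕ (b s iₛ) + ⟨ j ↾ s ⟩            ≡⟨ cong (_+ ⟨ j ↾ s ⟩) a≡b ⟨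
    toℕ (a s iₛ) + ⟨ j ↾ s ⟩            ∎)
    where open ≡-Reasoning

type-increases : (a b c₀ c₁ c₂ d : I t k) → A a c₀ → A b c₁ → A a c₂ → A b d → A a d →
  a <L b → c₀ <L c₁ → c₁ <L c₂ → c₂ <L d → (r s u : Fin t) →
  IsType a b r → IsType c₀ d s → IsType c₂ d u → r Data.Fin.≤ s → s < u
type-increases a b c₀ c₁ c₂ d ac₀ bc₁ ac₂ bd ad a<b c₀<c₁ c₁<c₂ c₂<d r s u a-b c₀-d c₂-d r≤s with s ≟ u
... | no s≢u = Finₚ.≤∧≢⇒< (type-≤-between c₀ c₂ d (<L-trans c₀<c₁ c₁<c₂) c₂<d s u c₀-d c₂-d) s≢u
... | yes refl with type-squeezed c₀<c₁ c₁<c₂ c₂<d c₀-d c₂-d | Finₚ.<-cmp r s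
...   | c₁-d | tri< r<s _ _ =
  ⊥-elim (no-nesting a b c₀ c₁ c₂ d ac₀ bc₁ ac₂ bd ad a<b c₀<c₁ c₁<c₂ c₂<d r s a-b r<s c₀-d c₁-d c₂-d)
...   | c₁-d | tri≈ _ refl _ = ⊥-elim (no-crossing a b c₁ c₂ d bc₁ ac₂ bd ad a<b c₁<c₂ c₂<d r a-b c₁-d c₂-d)
...   | _    | tri> _ _ s<r = contradiction r≤s (ℕₚ.<⇒≱ s<r)

lemma3 : (t k : ℕ) → 2 ≤ t → 1 ≤ k →
  ((a b c : I t k) → a <L b → b <L c → (r s : Fin t) →
     IsType a c r → IsType b c s → r Data.Fin.≤ s)
  ×
  ((a b c : I t k) (i j : Vec (Fin k) t) → a <L b →
     DiffIs c a i → DiffIs c b j → (r : Fin t) → IsType a b r →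
     ((q : Fin t) → q < r → lookup i q ≡ lookup j q) ×
     (lookup i r < lookup j r) ×
     FirstDiff a b r (lookup i r))
  ×
  ((a c d : I t k) (i j : Vec (Fin k) t) → c <L d →
     DiffIs c a i → DiffIs d a j → (r : Fin t) → IsType c d r →
     ((q : Fin t) → q < r → lookup i q ≡ lookup j q) ×
     (lookup j r < lookup i r) ×
     FirstDiff c d r (lookup j r))
  ×
  ((a b c₁ c₂ d : I t k) → A b c₁ → A a c₂ → A b d → A a d →
     a <L b → c₁ <L c₂ → c₂ <L d → (r : Fin t) →
     IsType a b r → IsType c₁ d r → IsType c₂ d r → ⊥)
  ×
  ((a b c₀ c₁ c₂ d : I t k) → A a c₀ → A b c₁ → A a c₂ → A b d → A a d →
     a <L b → c₀ <L c₁ → c₁ <L c₂ → c₂ <L d → (r s u : Fin t) →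
     IsType a b r → IsType c₀ d s → IsType c₂ d u → r Data.Fin.≤ s → s < u)
lemma3 _ _ _ _ = type-≤-between , common-upper-first-diff , common-lower-first-diff , no-crossing , type-increases
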